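{- Let $x = s_{i_1} s_{i_2} \cdots s_{i_k} s_{i_{k+1}} s_{i_k} \cdots s_{i_2} s_{i_1}$ be a reduced braid cluster of length $2k+1$ in the symmetric group $S_n$ (type $A$). Then, as an element of $S_n$, $x = s_{m+1} s_{m+2} \cdots s_{m+k} s_{m+k+1} s_{m+k} \cdots s_{m+2} s_{m+1}$ for some integer $m \geq 0$.
   Context: $S_n$ is viewed as a Coxeter group with generators $s_1,\dots,s_{n-1}$ (adjacent transpositions), relations $s_i^2=1$, $(s_is_{i\pm1})^3=1$, $(s_is_j)^2=1$ for $|i-j|\ge 2$. An expression is reduced if its length equals the minimal length of any expression for the same element. A braid cluster is an expression of the form $s_{i_1} s_{i_2} \cdots s_{i_k} s_{i_{k+1}} s_{i_k} \cdots s_{i_2} s_{i_1}$ where each $s_{i_p}$ with $1 \le p \le k$ has a unique $s_{i_q}$ with $p<q\le k+1$ such that $|i_p-i_q|=1$. -}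

module Defs where

open import Data.Nat using (ℕ; zero; suc; _+_; _≤_; _<_; _<?_)
open import Data.Fin using (Fin; toℕ; fromℕ<)
import Data.Fin as F
open import Data.Fin.Permutation using (Permutation′; id; transpose; _∘ₚ_; _⟨$⟩ʳ_)
open import Data.List using (List; []; _∷_; _++_; map; reverse; length)
open import Data.List.Relation.Unary.All using (All)
open import Data.Product using (_×_; ∃!)
open import Data.Sum using (_⊎_)
open import Relation.Binary.PropositionalEquality using (_≡_)
open import Relation.Nullary using (yes; no)
open import Data.Nat.Properties using (<-trans; n<1+n)
open import Data.List using (allFin; filter)

-- Expressions (words) in the Coxeter generators s_1, …, s_{n-1} of S_n
-- are lists of natural-number indices; index i stands for s_i.
Word : Set
Word = List ℕ

ValidWord : ℕ → Word → Set
ValidWord n w = All (λ i → 1 ≤ i × suc i ≤ n) w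

-- s_i ∈ S_n: the transposition of positions i and i+1
-- (positions 1..n are Fin n elements 0..n-1, so s_i swaps i-1 and i).
-- Only used on legal indices; out-of-range indices are sent to id.
gen : (n : ℕ) → ℕ → Permutation′ n
gen n zero = id
gen n (suc j) with suc j <? n
... | yes j+1<n = transpose (fromℕ< (<-trans (n<1+n j) j+1<n)) (fromℕ< j+1<n)
... | no _ = id

eval : (n : ℕ) → Word → Permutation′ n
eval n [] = id
eval n (i ∷ w) = gen n i ∘ₚ eval n w

_≈ₚ_ : {n : ℕ} → Permutation′ n → Permutation′ n → Set
π ≈ₚ ρ = ∀ x → π ⟨$⟩ʳ x ≡ ρ ⟨$⟩ʳ x

Reduced : ℕ → Word → Set
Reduced n w = ∀ (w′ : Word) → ValidWord n w′ → eval n w′ ≈ₚ eval n w → length w ≤ length w′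

-- indices i_1, …, i_{k+1} given as a function idx : Fin (suc k) → ℕ,
-- idx p = i_{p+1}. The word s_{i_1} ⋯ s_{i_k} s_{i_{k+1}} s_{i_k} ⋯ s_{i_1}:
clusterWord : (k : ℕ) → (Fin (suc k) → ℕ) → Word
clusterWord k idx = map idx (allFin (suc k)) ++ reverse (map (λ p → idx (F.inject₁ p)) (allFin k))

Adjacent : ℕ → ℕ → Set
Adjacent a b = a ≡ suc b ⊎ b ≡ suc a

IsBraidCluster : (k : ℕ) → (Fin (suc k) → ℕ) → Set
IsBraidCluster k idx =
  ∀ (p : Fin k) → ∃! _≡_ (λ (q : Fin (suc k)) → F.inject₁ p F.< q × Adjacent (idx (F.inject₁ p)) (idx q))

-- A palindrome w s_b wᴿ is the conjugate of s_b by w, hence the transposition of the two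
-- positions that wᴿ sends b − 1 and b to. Each letter increases the distance between two
-- positions by at most one, so these positions are at most k + 1 apart. The transposition of
-- m and m + d + 1 is also represented by the consecutive cluster of length 2d + 1; reducedness
-- of the given word of length 2k + 1 forces d ≥ k, hence d = k.
module Submission where

open import Defs
open import Data.Nat using (ℕ; zero; suc; pred; _+_; _≤_; _<_; _<?_; s≤s; s≤s⁻¹; z≤n; ∣_-_∣)
open import Data.Nat.Properties
open import Data.Fin using (Fin; toℕ; fromℕ; inject₁)
import Data.Fin as F
import Data.Fin.Properties as Fin
open import Data.Fin.Permutation using (Permutation′; _⟨$⟩ʳ_)
import Data.Fin.Permutation.Components as Components
open import Data.List using ([]; _∷_; _++_; _∷ʳ_; map; reverse; length; tabulate; allFin; applyUpTo; applyDownFrom)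
open import Data.List.Properties
open import Data.List.Relation.Unary.All using (All; []; _∷_; universal)
import Data.List.Relation.Unary.All.Properties as All
open import Data.Product using (∃; ∃₂; _×_; _,_; proj₁; proj₂)
open import Data.Sum using (_⊎_; inj₁; inj₂)
open import Data.Empty using (⊥-elim)
open import Function using (_∘_; id)
open import Relation.Binary using (tri<; tri≈; tri>)
open import Relation.Binary.PropositionalEquality
open import Relation.Nullary using (Dec; yes; no)

private
  variable
    a c n x : ℕ

transposeℕ : ℕ → ℕ → ℕ → ℕ
transposeℕ a c x with x ≟ a
... | yes _ = c
... | no _ with x ≟ c
...   | yes _ = a
...   | no _ = x

transposeℕ-left : ∀ a c → transposeℕ a c a ≡ c
transposeℕ-left a c with a ≟ a
... | yes _ = refl
... | no a≢a = ⊥-elim (a≢a refl)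

transposeℕ-right : ∀ a c → transposeℕ a c c ≡ a
transposeℕ-right a c with c ≟ a
... | yes c≡a = c≡a
... | no _ with c ≟ c
...   | yes _ = refl
...   | no c≢c = ⊥-elim (c≢c refl)

transposeℕ-fixes : x ≢ a → x ≢ c → transposeℕ a c x ≡ x
transposeℕ-fixes {x} {a} {c} x≢a x≢c with x ≟ a
... | yes x≡a = ⊥-elim (x≢a x≡a)
... | no _ with x ≟ c
...   | yes x≡c = ⊥-elim (x≢c x≡c)
...   | no _ = refl

transposeℕ-comm : ∀ a c x → transposeℕ a c x ≡ transposeℕ c a x
transposeℕ-comm a c x = cases (x ≟ a) (x ≟ c)
  where
  cases : Dec (x ≡ a) → Dec (x ≡ c) → transposeℕ a c x ≡ transposeℕ c a x
  cases (yes refl) _ = trans (transposeℕ-left x c) (sym (transposeℕ-right c x))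
  cases (no _) (yes refl) = trans (transposeℕ-right a x) (sym (transposeℕ-left x a))
  cases (no x≢a) (no x≢c) = trans (transposeℕ-fixes x≢a x≢c) (sym (transposeℕ-fixes x≢c x≢a))

transposeℕ-involutive : ∀ a c x → transposeℕ a c (transposeℕ a c x) ≡ x
transposeℕ-involutive a c x = cases (x ≟ a) (x ≟ c)
  where
  cases : Dec (x ≡ a) → Dec (x ≡ c) → transposeℕ a c (transposeℕ a c x) ≡ x
  cases (yes refl) _ = trans (cong (transposeℕ x c) (transposeℕ-left x c)) (transposeℕ-right x c)
  cases (no _) (yes refl) = trans (cong (transposeℕ a x) (transposeℕ-right a x)) (transposeℕ-left a x)
  cases (no x≢a) (no x≢c) =
    trans (cong (transposeℕ a c) (transposeℕ-fixes x≢a x≢c)) (transposeℕ-fixes x≢a x≢c)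

transposeℕ-< : a < n → c < n → x < n → transposeℕ a c x < n
transposeℕ-< {a} {n} {c} {x} a<n c<n x<n with x ≟ a
... | yes _ = c<n
... | no _ with x ≟ c
...   | yes _ = a<n
...   | no _ = x<n

transposeℕ-conjugate : ∀ (f g : ℕ → ℕ) → (∀ x → g (f x) ≡ x) → (∀ y → f (g y) ≡ y) →
                       ∀ x → g (transposeℕ a c (f x)) ≡ transposeℕ (g a) (g c) x
transposeℕ-conjugate {a} {c} f g gf fg x = cases (x ≟ g a) (x ≟ g c)
  where
  open ≡-Reasoning
  g-reflects : ∀ {y} → f x ≡ y → x ≡ g y
  g-reflects refl = sym (gf x)
  cases : Dec (x ≡ g a) → Dec (x ≡ g c) → g (transposeℕ a c (f x)) ≡ transposeℕ (g a) (g c) x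
  cases (yes refl) _ = begin
    g (transposeℕ a c (f (g a)))  ≡⟨ cong (g ∘ transposeℕ a c) (fg a) ⟩
    g (transposeℕ a c a)          ≡⟨ cong g (transposeℕ-left a c) ⟩
    g c                           ≡⟨ transposeℕ-left (g a) (g c) ⟨
    transposeℕ (g a) (g c) (g a)  ∎
  cases (no _) (yes refl) = begin
    g (transposeℕ a c (f (g c)))  ≡⟨ cong (g ∘ transposeℕ a c) (fg c) ⟩
    g (transposeℕ a c c)          ≡⟨ cong g (transposeℕ-right a c) ⟩
    g a                           ≡⟨ transposeℕ-right (g a) (g c) ⟨
    transposeℕ (g a) (g c) (g c)  ∎
  cases (no x≢ga) (no x≢gc) = begin
    g (transposeℕ a c (f x))  ≡⟨ cong g (transposeℕ-fixes (x≢ga ∘ g-reflects) (x≢gc ∘ g-reflects)) ⟩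
    g (f x)                   ≡⟨ gf x ⟩
    x                         ≡⟨ transposeℕ-fixes x≢ga x≢gc ⟨
    transposeℕ (g a) (g c) x  ∎

InAdjacentPair : ℕ → ℕ → Set
InAdjacentPair a x = x ≡ a ⊎ x ≡ suc a

∣n-1+n∣≡1 : ∀ n → ∣ n - suc n ∣ ≡ 1
∣n-1+n∣≡1 zero = refl
∣n-1+n∣≡1 (suc n) = ∣n-1+n∣≡1 n

adjacentPair-distance : ∀ {a u v} → InAdjacentPair a u → InAdjacentPair a v → ∣ u - v ∣ ≤ 1
adjacentPair-distance {a} (inj₁ refl) (inj₁ refl) = ≤-trans (≤-reflexive (∣n-n∣≡0 a)) z≤n
adjacentPair-distance {a} (inj₁ refl) (inj₂ refl) = ≤-reflexive (∣n-1+n∣≡1 a)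
adjacentPair-distance {a} (inj₂ refl) (inj₁ refl) = ≤-reflexive (trans (∣-∣-comm (suc a) a) (∣n-1+n∣≡1 a))
adjacentPair-distance {a} (inj₂ refl) (inj₂ refl) = ≤-trans (≤-reflexive (∣n-n∣≡0 (suc a))) z≤n

adjacentTranspose-fixes-or-stays : ∀ a x →
  transposeℕ a (suc a) x ≡ x ⊎ (InAdjacentPair a x × InAdjacentPair a (transposeℕ a (suc a) x))
adjacentTranspose-fixes-or-stays a x = cases (x ≟ a) (x ≟ suc a)
  where
  cases : Dec (x ≡ a) → Dec (x ≡ suc a) →
    transposeℕ a (suc a) x ≡ x ⊎ (InAdjacentPair a x × InAdjacentPair a (transposeℕ a (suc a) x))
  cases (yes refl) _ = inj₂ (inj₁ refl , inj₂ (transposeℕ-left x (suc x)))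
  cases (no _) (yes refl) = inj₂ (inj₂ refl , inj₁ (transposeℕ-right a x))
  cases (no x≢a) (no x≢1+a) = inj₁ (transposeℕ-fixes x≢a x≢1+a)

adjacentTranspose-displacement : ∀ a x → ∣ transposeℕ a (suc a) x - x ∣ ≤ 1
adjacentTranspose-displacement a x with adjacentTranspose-fixes-or-stays a x
... | inj₁ fixed = ≤-trans (≤-reflexive (trans (cong (∣_- x ∣) fixed) (∣n-n∣≡0 x))) z≤n
... | inj₂ (near , near′) = adjacentPair-distance near′ near

adjacentTranspose-distance : ∀ a x y →
  ∣ transposeℕ a (suc a) x - transposeℕ a (suc a) y ∣ ≤ suc ∣ x - y ∣
adjacentTranspose-distance a x y
  with adjacentTranspose-fixes-or-stays a x | adjacentTranspose-fixes-or-stays a y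
... | inj₁ x-fixed | _ = begin
  ∣ τ x - τ y ∣            ≡⟨ cong (∣_- τ y ∣) x-fixed ⟩
  ∣ x - τ y ∣              ≤⟨ ∣-∣-triangle x y (τ y) ⟩
  ∣ x - y ∣ + ∣ y - τ y ∣  ≤⟨ +-monoʳ-≤ ∣ x - y ∣ (subst (_≤ 1) (∣-∣-comm (τ y) y) (adjacentTranspose-displacement a y)) ⟩
  ∣ x - y ∣ + 1            ≡⟨ +-comm ∣ x - y ∣ 1 ⟩
  suc ∣ x - y ∣            ∎
  where open ≤-Reasoning; τ = transposeℕ a (suc a)
... | _ | inj₁ y-fixed = begin
  ∣ τ x - τ y ∣            ≡⟨ cong (∣ τ x -_∣) y-fixed ⟩
  ∣ τ x - y ∣              ≤⟨ ∣-∣-triangle (τ x) x y ⟩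
  ∣ τ x - x ∣ + ∣ x - y ∣  ≤⟨ +-monoˡ-≤ ∣ x - y ∣ (adjacentTranspose-displacement a x) ⟩
  suc ∣ x - y ∣            ∎
  where open ≤-Reasoning; τ = transposeℕ a (suc a)
... | inj₂ (_ , x-near) | inj₂ (_ , y-near) = ≤-trans (adjacentPair-distance x-near y-near) (s≤s z≤n)

toℕ-transpose : ∀ {n} (i j x : Fin n) →
  toℕ (Components.transpose i j x) ≡ transposeℕ (toℕ i) (toℕ j) (toℕ x)
toℕ-transpose i j x with x F.≟ i | toℕ x ≟ toℕ i
... | yes _ | yes _ = refl
... | yes x≡i | no x≢i = ⊥-elim (x≢i (cong toℕ x≡i))
... | no x≢i | yes x≡i = ⊥-elim (x≢i (Fin.toℕ-injective x≡i))
... | no _ | no _ with x F.≟ j | toℕ x ≟ toℕ j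
...   | yes _ | yes _ = refl
...   | yes x≡j | no x≢j = ⊥-elim (x≢j (cong toℕ x≡j))
...   | no x≢j | yes x≡j = ⊥-elim (x≢j (Fin.toℕ-injective x≡j))
...   | no _ | no _ = refl

-- Letters act left to right, as in  eval n (i ∷ w) = gen n i ∘ₚ eval n w.
act : Word → ℕ → ℕ
act [] x = x
act (i ∷ w) x = act w (transposeℕ (pred i) i x)

toℕ-gen : ∀ {n i} (x : Fin n) → 1 ≤ i × suc i ≤ n →
  toℕ (gen n i ⟨$⟩ʳ x) ≡ transposeℕ (pred i) i (toℕ x)
toℕ-gen {n} {suc j} x (_ , 1+j<n) with suc j <? n
... | yes 1+j<n′ = trans (toℕ-transpose _ _ x)
  (cong₂ (λ a c → transposeℕ a c (toℕ x)) (Fin.toℕ-fromℕ< _) (Fin.toℕ-fromℕ< 1+j<n′))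
... | no 1+j≮n = ⊥-elim (1+j≮n 1+j<n)

toℕ-eval : ∀ {n w} (x : Fin n) → ValidWord n w → toℕ (eval n w ⟨$⟩ʳ x) ≡ act w (toℕ x)
toℕ-eval x [] = refl
toℕ-eval {w = i ∷ w} x (i-valid ∷ w-valid) =
  trans (toℕ-eval _ w-valid) (cong (act w) (toℕ-gen x i-valid))

act-++ : ∀ u v x → act (u ++ v) x ≡ act v (act u x)
act-++ [] v x = refl
act-++ (i ∷ u) v x = act-++ u v _

act-reverse-inverseˡ : ∀ w x → act (reverse w) (act w x) ≡ x
act-reverse-inverseˡ [] x = refl
act-reverse-inverseˡ (i ∷ w) x = begin
  act (reverse (i ∷ w)) (act w (τ x))  ≡⟨ cong (λ u → act u (act w (τ x))) (unfold-reverse i w) ⟩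
  act (reverse w ∷ʳ i) (act w (τ x))   ≡⟨ act-++ (reverse w) (i ∷ []) _ ⟩
  τ (act (reverse w) (act w (τ x)))    ≡⟨ cong τ (act-reverse-inverseˡ w (τ x)) ⟩
  τ (τ x)                              ≡⟨ transposeℕ-involutive (pred i) i x ⟩
  x                                    ∎
  where open ≡-Reasoning; τ = transposeℕ (pred i) i

act-reverse-inverseʳ : ∀ w x → act w (act (reverse w) x) ≡ x
act-reverse-inverseʳ w x =
  subst (λ u → act u (act (reverse w) x) ≡ x) (reverse-involutive w) (act-reverse-inverseˡ (reverse w) x)

act-palindrome : ∀ w b x →
  act (w ++ b ∷ reverse w) x ≡ transposeℕ (act (reverse w) (pred b)) (act (reverse w) b) x
act-palindrome w b x = trans (act-++ w (b ∷ reverse w) x)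
  (transposeℕ-conjugate (act w) (act (reverse w)) (act-reverse-inverseˡ w) (act-reverse-inverseʳ w) x)

act-injective : ∀ w {x y} → act w x ≡ act w y → x ≡ y
act-injective w {x} {y} eq = begin
  x                             ≡⟨ act-reverse-inverseˡ w x ⟨
  act (reverse w) (act w x)     ≡⟨ cong (act (reverse w)) eq ⟩
  act (reverse w) (act w y)     ≡⟨ act-reverse-inverseˡ w y ⟩
  y                             ∎
  where open ≡-Reasoning

act-< : ∀ {n w x} → ValidWord n w → x < n → act w x < n
act-< [] x<n = x<n
act-< {w = suc j ∷ w} ((_ , 1+j<n) ∷ w-valid) x<n =
  act-< w-valid (transposeℕ-< (<-trans (n<1+n j) 1+j<n) 1+j<n x<n)

act-distance : ∀ {n w} → ValidWord n w → ∀ x y → ∣ act w x - act w y ∣ ≤ length w + ∣ x - y ∣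
act-distance [] x y = ≤-refl
act-distance {w = suc j ∷ w} (_ ∷ w-valid) x y = begin
  ∣ act w (τ x) - act w (τ y) ∣  ≤⟨ act-distance w-valid (τ x) (τ y) ⟩
  length w + ∣ τ x - τ y ∣        ≤⟨ +-monoʳ-≤ (length w) (adjacentTranspose-distance j x y) ⟩
  length w + suc ∣ x - y ∣        ≡⟨ +-suc (length w) ∣ x - y ∣ ⟩
  suc (length w + ∣ x - y ∣)      ∎
  where open ≤-Reasoning; τ = transposeℕ j (suc j)

adjacentPair-image : ∀ {n w b} → ValidWord n w → 1 ≤ b → b < n →
  act w (pred b) ≢ act w b × act w (pred b) < n × act w b < n ×
  ∣ act w (pred b) - act w b ∣ ≤ suc (length w)
adjacentPair-image {w = w} {suc j} w-valid (s≤s z≤n) 1+j<n =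
  (λ eq → 1+n≢n (sym (act-injective w eq))) ,
  act-< w-valid (<-trans (n<1+n j) 1+j<n) ,
  act-< w-valid 1+j<n ,
  ≤-trans (act-distance w-valid j (suc j))
          (≤-reflexive (trans (cong (length w +_) (∣n-1+n∣≡1 j)) (+-comm (length w) 1)))

tabulate-∷ʳ : ∀ {A : Set} {k} (f : Fin (suc k) → A) → tabulate f ≡ tabulate (f ∘ inject₁) ∷ʳ f (fromℕ k)
tabulate-∷ʳ {k = zero} f = refl
tabulate-∷ʳ {k = suc k} f = cong (f F.zero ∷_) (tabulate-∷ʳ (f ∘ F.suc))

tabulate-applyUpTo : ∀ {A : Set} {k} (f : Fin k → A) (g : ℕ → A) → (∀ t → f t ≡ g (toℕ t)) →
  tabulate f ≡ applyUpTo g k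
tabulate-applyUpTo {k = zero} f g f≗g = refl
tabulate-applyUpTo {k = suc k} f g f≗g =
  cong₂ _∷_ (f≗g F.zero) (tabulate-applyUpTo (f ∘ F.suc) (g ∘ suc) (f≗g ∘ F.suc))

clusterPrefix : (k : ℕ) → (Fin (suc k) → ℕ) → Word
clusterPrefix k idx = tabulate (idx ∘ inject₁)

clusterWord-palindrome : ∀ k idx →
  clusterWord k idx ≡ clusterPrefix k idx ++ idx (fromℕ k) ∷ reverse (clusterPrefix k idx)
clusterWord-palindrome k idx = begin
  map idx (allFin (suc k)) ++ reverse (map (idx ∘ inject₁) (allFin k))
    ≡⟨ cong₂ (λ u v → u ++ reverse v) (map-tabulate id idx) (map-tabulate id (idx ∘ inject₁)) ⟩
  tabulate idx ++ reverse W
    ≡⟨ cong (_++ reverse W) (tabulate-∷ʳ idx) ⟩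
  (W ∷ʳ idx (fromℕ k)) ++ reverse W
    ≡⟨ ++-assoc W (idx (fromℕ k) ∷ []) (reverse W) ⟩
  W ++ idx (fromℕ k) ∷ reverse W  ∎
  where open ≡-Reasoning; W = clusterPrefix k idx

length-clusterWord : ∀ k idx → length (clusterWord k idx) ≡ k + suc k
length-clusterWord k idx = begin
  length (map idx (allFin (suc k)) ++ reverse (map (idx ∘ inject₁) (allFin k)))
    ≡⟨ length-++ (map idx (allFin (suc k))) ⟩
  length (map idx (allFin (suc k))) + length (reverse (map (idx ∘ inject₁) (allFin k)))
    ≡⟨ cong₂ _+_ (trans (length-map idx (allFin (suc k))) (length-tabulate {n = suc k} id))
                 (trans (length-reverse (map (idx ∘ inject₁) (allFin k)))
                        (trans (length-map (idx ∘ inject₁) (allFin k)) (length-tabulate {n = k} id))) ⟩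
  suc k + k
    ≡⟨ +-suc k k ⟨
  k + suc k  ∎
  where open ≡-Reasoning

clusterWord-valid : ∀ {n} k idx → (∀ t → 1 ≤ idx t × suc (idx t) ≤ n) → ValidWord n (clusterWord k idx)
clusterWord-valid k idx idx-valid = All.++⁺ (All.map⁺ (universal idx-valid (allFin (suc k))))
  (subst (All _) (reverse-map (idx ∘ inject₁) (allFin k))
         (All.map⁺ (universal (idx-valid ∘ inject₁) (reverse (allFin k)))))

consecutiveCluster : ℕ → ℕ → Word
consecutiveCluster m k = clusterWord k (λ t → m + suc (toℕ t))

consecutiveCluster-valid : ∀ {n} m k → suc (m + k) < n → ValidWord n (consecutiveCluster m k)
consecutiveCluster-valid m k m+k+1<n = clusterWord-valid k _ λ t →
  ≤-trans (s≤s z≤n) (m≤n+m (suc (toℕ t)) m) ,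
  ≤-trans (s≤s (≤-reflexive (+-suc m (toℕ t)))) (≤-trans (s≤s (s≤s (+-monoʳ-≤ m (Fin.toℕ≤pred[n] t)))) m+k+1<n)

descending : ℕ → ℕ → Word
descending m = applyDownFrom (λ i → suc (i + m))

descending-moves : ∀ m k → act (descending m k) (k + m) ≡ m
descending-moves m zero = refl
descending-moves m (suc k) =
  trans (cong (act (descending m k)) (transposeℕ-right (k + m) (suc (k + m)))) (descending-moves m k)

descending-fixes : ∀ m k {y} → k + m < y → act (descending m k) y ≡ y
descending-fixes m zero k+m<y = refl
descending-fixes m (suc k) {y} 1+k+m<y =
  trans (cong (act (descending m k)) (transposeℕ-fixes (>⇒≢ k+m<y) (>⇒≢ 1+k+m<y)))
        (descending-fixes m k k+m<y)
  where k+m<y = <-trans (n<1+n (k + m)) 1+k+m<y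

consecutiveCluster-act : ∀ m k x → act (consecutiveCluster m k) x ≡ transposeℕ m (suc (m + k)) x
consecutiveCluster-act m k x = begin
  act (consecutiveCluster m k) x
    ≡⟨ cong (λ w → act w x) (clusterWord-palindrome k f) ⟩
  act (W ++ b ∷ reverse W) x
    ≡⟨ act-palindrome W b x ⟩
  transposeℕ (act (reverse W) (pred b)) (act (reverse W) b) x
    ≡⟨ cong₂ (λ R b → transposeℕ (act R (pred b)) (act R b) x) reverse-W≡descending b≡1+k+m ⟩
  transposeℕ (act (descending m k) (k + m)) (act (descending m k) (suc (k + m))) x
    ≡⟨ cong₂ (λ u v → transposeℕ u v x) (descending-moves m k) (descending-fixes m k (n<1+n (k + m))) ⟩
  transposeℕ m (suc (k + m)) x
    ≡⟨ cong (λ t → transposeℕ m (suc t) x) (+-comm k m) ⟩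
  transposeℕ m (suc (m + k)) x  ∎
  where
  open ≡-Reasoning
  f : Fin (suc k) → ℕ
  f t = m + suc (toℕ t)
  W = clusterPrefix k f
  b = f (fromℕ k)
  m+1+t≡1+t+m : ∀ t → m + suc t ≡ suc (t + m)
  m+1+t≡1+t+m t = +-comm m (suc t)
  reverse-W≡descending : reverse W ≡ descending m k
  reverse-W≡descending = trans
    (cong reverse (tabulate-applyUpTo (f ∘ inject₁) (λ i → suc (i + m))
      λ t → trans (cong (λ i → m + suc i) (Fin.toℕ-inject₁ t)) (m+1+t≡1+t+m (toℕ t))))
    (reverse-applyUpTo _ k)
  b≡1+k+m : b ≡ suc (k + m)
  b≡1+k+m = trans (cong (λ i → m + suc i) (Fin.toℕ-fromℕ k)) (m+1+t≡1+t+m k)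

ActsAsTransposition : ∀ {n} → Permutation′ n → ℕ → ℕ → Set
ActsAsTransposition π a c = ∀ x → toℕ (π ⟨$⟩ʳ x) ≡ transposeℕ a c (toℕ x)

clusterWord-transposition : ∀ {n} k idx → ValidWord n (clusterWord k idx) →
  ∃₂ λ a c → a ≢ c × a < n × c < n × ∣ a - c ∣ ≤ suc k ×
             ActsAsTransposition (eval n (clusterWord k idx)) a c
clusterWord-transposition {n} k idx valid
  with b-valid ∷ R-valid ←
         All.++⁻ʳ (clusterPrefix k idx) (subst (ValidWord n) (clusterWord-palindrome k idx) valid)
  with a≢c , a<n , c<n , ∣a-c∣≤1+|R| ← adjacentPair-image R-valid (proj₁ b-valid) (proj₂ b-valid) =
  act R (pred b) , act R b , a≢c , a<n , c<n ,
  subst (λ l → ∣ act R (pred b) - act R b ∣ ≤ suc l) length-R ∣a-c∣≤1+|R| , acts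
  where
  W = clusterPrefix k idx
  R = reverse W
  b = idx (fromℕ k)
  length-R : length R ≡ k
  length-R = trans (length-reverse W) (length-tabulate (idx ∘ inject₁))
  acts : ActsAsTransposition (eval n (clusterWord k idx)) (act R (pred b)) (act R b)
  acts x = trans (toℕ-eval x valid)
    (trans (cong (λ w → act w (toℕ x)) (clusterWord-palindrome k idx)) (act-palindrome W b (toℕ x)))

transposition-consecutiveCluster : ∀ {n} (π : Permutation′ n) m d → suc (m + d) < n →
  ActsAsTransposition π m (suc (m + d)) → π ≈ₚ eval n (consecutiveCluster m d)
transposition-consecutiveCluster {n} π m d m+d+1<n acts x = Fin.toℕ-injective (begin
  toℕ (π ⟨$⟩ʳ x)                                ≡⟨ acts x ⟩
  transposeℕ m (suc (m + d)) (toℕ x)            ≡⟨ consecutiveCluster-act m d (toℕ x) ⟨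
  act (consecutiveCluster m d) (toℕ x)          ≡⟨ toℕ-eval x (consecutiveCluster-valid m d m+d+1<n) ⟨
  toℕ (eval n (consecutiveCluster m d) ⟨$⟩ʳ x)  ∎)
  where open ≡-Reasoning

ConsecutiveClusterOf : (n k : ℕ) → Permutation′ n → Set
ConsecutiveClusterOf n k π = ∃ λ m → ValidWord n (consecutiveCluster m k) × π ≈ₚ eval n (consecutiveCluster m k)

m+1+m≤n+1+n⇒m≤n : ∀ {m n} → m + suc m ≤ n + suc n → m ≤ n
m+1+m≤n+1+n⇒m≤n le = ≮⇒≥ (λ n<m → <⇒≱ (+-mono-< n<m (s≤s n<m)) le)

∣m-1+m+n∣≡1+n : ∀ m n → ∣ m - suc (m + n) ∣ ≡ suc n
∣m-1+m+n∣≡1+n m n = trans (cong (∣ m -_∣) (sym (+-suc m n))) (∣m-m+n∣≡n m (suc n))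

reduced-length≤consecutiveCluster : ∀ {n} w m d → Reduced n w → suc (m + d) < n →
  ActsAsTransposition (eval n w) m (suc (m + d)) → length w ≤ d + suc d
reduced-length≤consecutiveCluster {n} w m d reduced m+d+1<n acts = begin
  length w   ≤⟨ reduced T (consecutiveCluster-valid m d m+d+1<n) (λ x → sym (w≈T x)) ⟩
  length T   ≡⟨ length-clusterWord d _ ⟩
  d + suc d  ∎
  where
  open ≤-Reasoning
  T : Word
  T = consecutiveCluster m d
  w≈T : eval n w ≈ₚ eval n T
  w≈T = transposition-consecutiveCluster (eval n w) m d m+d+1<n acts

orderedTransposition⇒consecutiveCluster : ∀ {n k a c} w → Reduced n w → length w ≡ k + suc k →
  a < c → c < n → ∣ a - c ∣ ≤ suc k → ActsAsTransposition (eval n w) a c →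
  ConsecutiveClusterOf n k (eval n w)
orderedTransposition⇒consecutiveCluster {k = k} {a = a} w reduced length-w a<c c<n ∣a-c∣≤1+k acts
  with d , refl ← m≤n⇒∃[o]m+o≡n a<c
  with refl ← ≤-antisym (s≤s⁻¹ (subst (_≤ suc k) (∣m-1+m+n∣≡1+n a d) ∣a-c∣≤1+k))
                (m+1+m≤n+1+n⇒m≤n (subst (_≤ d + suc d) length-w
                  (reduced-length≤consecutiveCluster w a d reduced c<n acts)))
  = a , consecutiveCluster-valid a d c<n , transposition-consecutiveCluster (eval _ w) a d c<n acts

transposition⇒consecutiveCluster : ∀ {n k a c} w → Reduced n w → length w ≡ k + suc k →
  a ≢ c → a < n → c < n → ∣ a - c ∣ ≤ suc k → ActsAsTransposition (eval n w) a c →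
  ConsecutiveClusterOf n k (eval n w)
transposition⇒consecutiveCluster {k = k} {a = a} {c} w reduced length-w a≢c a<n c<n ∣a-c∣≤1+k acts
  with <-cmp a c
... | tri< a<c _ _ = orderedTransposition⇒consecutiveCluster w reduced length-w a<c c<n ∣a-c∣≤1+k acts
... | tri≈ _ a≡c _ = ⊥-elim (a≢c a≡c)
... | tri> _ _ c<a = orderedTransposition⇒consecutiveCluster w reduced length-w c<a a<n
  (subst (_≤ suc k) (∣-∣-comm a c) ∣a-c∣≤1+k) (λ x → trans (acts x) (transposeℕ-comm a c (toℕ x)))

lemma1p6 : (n k : ℕ) (idx : Fin (suc k) → ℕ) →
    IsBraidCluster k idx →
    ValidWord n (clusterWord k idx) →
    Reduced n (clusterWord k idx) →
    ∃ λ (m : ℕ) →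
      ValidWord n (clusterWord k (λ j → m + suc (toℕ j))) ×
      eval n (clusterWord k idx) ≈ₚ eval n (clusterWord k (λ j → m + suc (toℕ j)))
lemma1p6 n k idx _ valid reduced =
  let a , c , a≢c , a<n , c<n , ∣a-c∣≤1+k , acts = clusterWord-transposition k idx valid
  in transposition⇒consecutiveCluster (clusterWord k idx) reduced (length-clusterWord k idx)
       a≢c a<n c<n ∣a-c∣≤1+k acts
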